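{- For every integer $n\ge 2$, $|L_n(3)|=|L_n(4)|=|L_n(5)|=g(n-1)-2g(n-2)$, where $g(m)=(2^m+1)(2^{m-1}+1)/3$ for $m\ge 0$.
   Context: For $n\ge1$, let $L_n$ be the set of words $a=a_1\cdots a_n$ over $\{1,2,3,4\}$ with $0<a_i\le \max_{0\le j<i}a_j+1$ for all $i$, where by convention $a_0=1$. Let $E_i:L_n\to L_{n-1}$-type operation denote erasing the $i$-th letter (from the left) of a word. Define $L_n(1)=\{a\in L_n:a_n=1\}$, $L_n(2)=\{a\in L_n: a_n=\max_{0\le j<n}a_j+1\text{ or }a_n=4\}$, and for $n\ge2$ and $k\in\{1,2,3\}$, $L_n(k+2)=\{a\in L_n\setminus(L_n(1)\cup L_n(2)): a_{n-1}=k,\ E_{n-1}(a)\notin L_{n-1}(1)\cup L_{n-1}(2)\}$. -}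

module Defs where

open import Data.Nat using (ℕ; zero; suc; _+_; _*_; _^_; _⊔_; _≤ᵇ_; _≡ᵇ_; _/_)
open import Data.Bool using (Bool; true; false; _∧_; _∨_; not)
open import Data.List using (List; []; _∷_; concatMap; length; filterᵇ; map; _++_; [_]; reverse)

-- Words a = a₁ ⋯ aₙ are lists of natural numbers, read left to right.

allWords : ℕ → List (List ℕ)
allWords zero = [] ∷ []
allWords (suc n) = concatMap (λ w → map (λ x → x ∷ w) (1 ∷ 2 ∷ 3 ∷ 4 ∷ [])) (allWords n)

-- isRG m w : every letter aᵢ of w satisfies 0 < aᵢ ≤ 4 and aᵢ ≤ M + 1, where M is the
-- maximum of m and the letters before aᵢ.  With m = a₀ = 1 this is membership in Lₙ.
isRG : ℕ → List ℕ → Bool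
isRG m [] = true
isRG m (a ∷ w) = (1 ≤ᵇ a) ∧ (a ≤ᵇ 4) ∧ (a ≤ᵇ suc m) ∧ isRG (m ⊔ a) w

inL : List ℕ → Bool
inL w = isRG 1 w

maxPref : List ℕ → ℕ
maxPref [] = 1
maxPref (a ∷ p) = a ⊔ maxPref p

-- For a word w = p ++ [x] (of length n = |p|+1):
--   w ∈ Lₙ(1)  iff  x = 1
--   w ∈ Lₙ(2)  iff  x = max_{0≤j<n} a_j + 1  or  x = 4
in1 : List ℕ → ℕ → Bool
in1 p x = x ≡ᵇ 1

in2 : List ℕ → ℕ → Bool
in2 p x = (x ≡ᵇ suc (maxPref p)) ∨ (x ≡ᵇ 4)

-- w = q ++ [y] ++ [x] (length n = |q| + 2 ≥ 2) lies in Lₙ(k+2) iff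
--   w ∈ Lₙ, w ∉ Lₙ(1) ∪ Lₙ(2), a_{n-1} = y = k, and
--   E_{n-1}(w) = q ++ [x] ∉ L_{n-1}(1) ∪ L_{n-1}(2).
inKplus2' : ℕ → List ℕ → ℕ → ℕ → Bool
inKplus2' k q y x =
  inL (q ++ y ∷ x ∷ [])
  ∧ not (in1 (q ++ [ y ]) x ∨ in2 (q ++ [ y ]) x)
  ∧ (y ≡ᵇ k)
  ∧ not (in1 q x ∨ in2 q x)

-- For words of length < 2 the set Lₙ(k+2) is not defined; we return false
-- (never used, since n ≥ 2 below).
splitLast2 : ℕ → List ℕ → Bool
splitLast2 k (x ∷ y ∷ rq) = inKplus2' k (reverse rq) y x
splitLast2 k _ = false

inKplus2 : ℕ → List ℕ → Bool
inKplus2 k w = splitLast2 k (reverse w)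

cardL : ℕ → ℕ → ℕ
cardL k n = length (filterᵇ (inKplus2 k) (allWords n))

-- g(m) = (2^m + 1)(2^{m-1} + 1)/3 = (2^m + 1)(2^m + 2)/6, an exact division.
g : ℕ → ℕ
g m = ((2 ^ m + 1) * (2 ^ m + 2)) / 6

-- A word of Lₙ(k+2), n = m + 2, is a word u ∈ Lₘ followed by two letters y x, and whether
-- y x is admissible depends only on k and the maximum M of u: for k ∈ {1,2,3} there are
-- 0, 1, 2 admissible endings according as M = 1, M = 2, M ≥ 3.  Hence |Lₙ(k+2)| = Tₘ,
-- the sum over u ∈ Lₘ of this weight.  Appending one letter to a word of maximum M
-- multiplies its weight by 4, except that from M = 1 the new letter 2 adds one more; as
-- 1ᵐ is the only word of Lₘ with maximum 1, T₍ₘ₊₁₎ = 4 Tₘ + 1, so Tₘ = (4ᵐ − 1)/3, which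
-- is also g(m+1) − 2 g(m).
module Submission where

open import Defs
open import Data.Nat using (ℕ; suc)
open import Data.Integer using (ℤ; +_; _-_; _*_)
open import Data.Product using (_×_)
open import Relation.Binary.PropositionalEquality using (_≡_)

open import Data.Bool using (Bool; true; false; _∧_; _∨_; not; if_then_else_)
open import Data.Bool.Properties using (∧-assoc)
open import Data.Integer using (_⊖_)
open import Data.Integer.Properties as ℤ using ()
open import Data.List using (List; []; _∷_; _++_; [_]; map; concatMap; filterᵇ; length; reverse)
open import Data.List.Properties using (map-cong; map-++; reverse-++; reverse-involutive)
open import Data.Nat as ℕ using (zero; _+_; _≤ᵇ_; _≤_; z≤n; s≤s; _⊔_; _≡ᵇ_; _^_; _/_)
open import Data.Nat.DivMod using (m*n/n≡m)
open import Data.Nat.ListAction using (sum)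
open import Data.Nat.ListAction.Properties using (sum-++)
open import Data.Nat.Properties as ℕ using ()
open import Data.Nat.Tactic.RingSolver using (solve-∀)
open import Data.Product using (_,_)
open import Relation.Binary.PropositionalEquality using (refl; sym; trans; cong; cong₂; module ≡-Reasoning)

open ≡-Reasoning
open import Algebra.Properties.CommutativeSemigroup ℕ.+-commutativeSemigroup using (interchange)

private
  variable
    A B : Set

sumOver : List A → (A → ℕ) → ℕ
sumOver xs f = sum (map f xs)

sumOver-cong : ∀ (xs : List A) {f g : A → ℕ} → (∀ x → f x ≡ g x) → sumOver xs f ≡ sumOver xs g
sumOver-cong xs f≗g = cong sum (map-cong f≗g xs)

sumOver-zero : ∀ (xs : List A) → sumOver xs (λ _ → 0) ≡ 0
sumOver-zero []       = refl
sumOver-zero (_ ∷ xs) = sumOver-zero xs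

sumOver-+ : ∀ (xs : List A) (f g : A → ℕ) →
            sumOver xs (λ x → f x + g x) ≡ sumOver xs f + sumOver xs g
sumOver-+ []       f g = refl
sumOver-+ (x ∷ xs) f g = begin
  f x + g x + sumOver xs (λ y → f y + g y)      ≡⟨ cong (_+_ (f x + g x)) (sumOver-+ xs f g) ⟩
  f x + g x + (sumOver xs f + sumOver xs g)     ≡⟨ interchange (f x) (g x) _ _ ⟩
  f x + sumOver xs f + (g x + sumOver xs g)     ∎

sumOver-* : ∀ (xs : List A) (a : ℕ) (f : A → ℕ) → sumOver xs (λ x → a ℕ.* f x) ≡ a ℕ.* sumOver xs f
sumOver-* []       a f = sym (ℕ.*-zeroʳ a)
sumOver-* (x ∷ xs) a f = trans (cong (_+_ (a ℕ.* f x)) (sumOver-* xs a f))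
                               (sym (ℕ.*-distribˡ-+ a (f x) (sumOver xs f)))

sumOver-swap : ∀ (xs : List A) (ys : List B) (h : A → B → ℕ) →
               sumOver xs (λ x → sumOver ys (h x)) ≡ sumOver ys (λ y → sumOver xs (λ x → h x y))
sumOver-swap []       ys h = sym (sumOver-zero ys)
sumOver-swap (x ∷ xs) ys h = begin
  sumOver ys (h x) + sumOver xs (λ x′ → sumOver ys (h x′))        ≡⟨ cong (_+_ (sumOver ys (h x))) (sumOver-swap xs ys h) ⟩
  sumOver ys (h x) + sumOver ys (λ y → sumOver xs (λ x′ → h x′ y)) ≡⟨ sumOver-+ ys (h x) _ ⟨
  sumOver ys (λ y → h x y + sumOver xs (λ x′ → h x′ y))           ∎

sumOver-concatMap : ∀ (f : A → List B) (h : B → ℕ) xs →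
                    sumOver (concatMap f xs) h ≡ sumOver xs (λ x → sumOver (f x) h)
sumOver-concatMap f h []       = refl
sumOver-concatMap f h (x ∷ xs) = begin
  sum (map h (f x ++ concatMap f xs))                     ≡⟨ cong sum (map-++ h (f x) _) ⟩
  sum (map h (f x) ++ map h (concatMap f xs))             ≡⟨ sum-++ (map h (f x)) _ ⟩
  sumOver (f x) h + sumOver (concatMap f xs) h            ≡⟨ cong (_+_ (sumOver (f x) h)) (sumOver-concatMap f h xs) ⟩
  sumOver (f x) h + sumOver xs (λ x′ → sumOver (f x′) h)  ∎

length-filterᵇ : ∀ (p : A → Bool) xs → length (filterᵇ p xs) ≡ sumOver xs (λ x → if p x then 1 else 0)
length-filterᵇ p []       = refl
length-filterᵇ p (x ∷ xs) with p x
... | true  = cong suc (length-filterᵇ p xs)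
... | false = length-filterᵇ p xs

letters : List ℕ
letters = 1 ∷ 2 ∷ 3 ∷ 4 ∷ []

sumOver-allWords-cons : ∀ n (f : List ℕ → ℕ) →
  sumOver (allWords (suc n)) f ≡ sumOver (allWords n) (λ w → sumOver letters (λ x → f (x ∷ w)))
sumOver-allWords-cons n f = sumOver-concatMap (λ w → map (_∷ w) letters) f (allWords n)

sumOver-allWords-snoc : ∀ n (f : List ℕ → ℕ) →
  sumOver (allWords (suc n)) f ≡ sumOver (allWords n) (λ u → sumOver letters (λ z → f (u ++ [ z ])))
sumOver-allWords-snoc zero    f = sumOver-allWords-cons zero f
sumOver-allWords-snoc (suc n) f = begin
  sumOver (allWords (suc (suc n))) f
    ≡⟨ sumOver-allWords-cons (suc n) f ⟩
  sumOver (allWords (suc n)) (λ w → sumOver letters (λ x → f (x ∷ w)))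
    ≡⟨ sumOver-swap (allWords (suc n)) letters (λ w x → f (x ∷ w)) ⟩
  sumOver letters (λ x → sumOver (allWords (suc n)) (λ w → f (x ∷ w)))
    ≡⟨ sumOver-cong letters (λ x → sumOver-allWords-snoc n (λ w → f (x ∷ w))) ⟩
  sumOver letters (λ x → sumOver (allWords n) (λ u → sumOver letters (λ z → f (x ∷ u ++ [ z ]))))
    ≡⟨ sumOver-swap letters (allWords n) (λ x u → sumOver letters (λ z → f (x ∷ u ++ [ z ]))) ⟩
  sumOver (allWords n) (λ u → sumOver letters (λ x → sumOver letters (λ z → f (x ∷ u ++ [ z ]))))
    ≡⟨ sumOver-allWords-cons n (λ v → sumOver letters (λ z → f (v ++ [ z ]))) ⟨
  sumOver (allWords (suc n)) (λ v → sumOver letters (λ z → f (v ++ [ z ]))) ∎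

isRG-++ : ∀ m u v → 1 ≤ m → isRG m (u ++ v) ≡ isRG m u ∧ isRG (m ⊔ maxPref u) v
isRG-++ m []      v 1≤m = cong (λ m′ → isRG m′ v) (sym (ℕ.m≥n⇒m⊔n≡m 1≤m))
isRG-++ m (a ∷ u) v 1≤m with 1 ≤ᵇ a | a ≤ᵇ 4 | a ≤ᵇ suc m
... | false | _     | _     = refl
... | true  | false | _     = refl
... | true  | true  | false = refl
... | true  | true  | true  = trans (isRG-++ (m ⊔ a) u v (ℕ.≤-trans 1≤m (ℕ.m≤m⊔n m a)))
                                   (cong (λ m′ → isRG (m ⊔ a) u ∧ isRG m′ v) (ℕ.⊔-assoc m a (maxPref u)))

maxPref-snoc : ∀ u y → maxPref (u ++ [ y ]) ≡ maxPref u ⊔ y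
maxPref-snoc []      y = ℕ.⊔-comm y 1
maxPref-snoc (a ∷ u) y = trans (cong (a ⊔_) (maxPref-snoc u y)) (sym (ℕ.⊔-assoc a (maxPref u) y))

maxPref≥1 : ∀ u → 1 ≤ maxPref u
maxPref≥1 []      = s≤s z≤n
maxPref≥1 (a ∷ u) = ℕ.≤-trans (maxPref≥1 u) (ℕ.m≤n⊔m a (maxPref u))

byMax : (ℕ → ℕ) → List ℕ → ℕ
byMax φ u = if inL u then φ (maxPref u) else 0

countByMax : (ℕ → ℕ) → ℕ → ℕ
countByMax φ n = sumOver (allWords n) (byMax φ)

appendSum : (ℕ → ℕ) → ℕ → ℕ
appendSum φ M = sumOver letters (λ z → if isRG (1 ⊔ M) [ z ] then φ (M ⊔ z) else 0)

byMax-snoc : ∀ φ u → sumOver letters (λ z → byMax φ (u ++ [ z ])) ≡ byMax (appendSum φ) u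
byMax-snoc φ u = trans (sumOver-cong letters split) (appendSum-if (isRG 1 u))
  where
  split : ∀ z → byMax φ (u ++ [ z ]) ≡
                (if isRG 1 u ∧ isRG (1 ⊔ maxPref u) [ z ] then φ (maxPref u ⊔ z) else 0)
  split z = cong₂ (λ b M → if b then φ M else 0) (isRG-++ 1 u [ z ] (s≤s z≤n)) (maxPref-snoc u z)
  appendSum-if : ∀ b → sumOver letters (λ z → if b ∧ isRG (1 ⊔ maxPref u) [ z ] then φ (maxPref u ⊔ z) else 0)
                       ≡ (if b then appendSum φ (maxPref u) else 0)
  appendSum-if true  = refl
  appendSum-if false = refl

countByMax-suc : ∀ φ n → countByMax φ (suc n) ≡ countByMax (appendSum φ) n
countByMax-suc φ n = trans (sumOver-allWords-snoc n (byMax φ)) (sumOver-cong (allWords n) (byMax-snoc φ))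

countByMax-cong : ∀ {φ ψ} n → (∀ M → φ M ≡ ψ M) → countByMax φ n ≡ countByMax ψ n
countByMax-cong n φ≗ψ = sumOver-cong (allWords n) (λ u → cong (λ t → if inL u then t else 0) (φ≗ψ (maxPref u)))

countByMax-linear : ∀ a φ ψ n →
  countByMax (λ M → a ℕ.* φ M + ψ M) n ≡ a ℕ.* countByMax φ n + countByMax ψ n
countByMax-linear a φ ψ n = begin
  countByMax (λ M → a ℕ.* φ M + ψ M) n
    ≡⟨ sumOver-cong (allWords n) byMax-linear ⟩
  sumOver (allWords n) (λ u → a ℕ.* byMax φ u + byMax ψ u)
    ≡⟨ sumOver-+ (allWords n) _ (byMax ψ) ⟩
  sumOver (allWords n) (λ u → a ℕ.* byMax φ u) + countByMax ψ n
    ≡⟨ cong (_+ countByMax ψ n) (sumOver-* (allWords n) a (byMax φ)) ⟩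
  a ℕ.* countByMax φ n + countByMax ψ n ∎
  where
  byMax-linear : ∀ u → byMax (λ M → a ℕ.* φ M + ψ M) u ≡ a ℕ.* byMax φ u + byMax ψ u
  byMax-linear u with inL u
  ... | true  = refl
  ... | false = sym (trans (ℕ.+-identityʳ (a ℕ.* 0)) (ℕ.*-zeroʳ a))

-- Maxima are ≥ 1, but the value 1 at 0 makes appendSum-atMostOne and
-- appendSum-endingWeight hold for every M.
atMostOne : ℕ → ℕ
atMostOne 0             = 1
atMostOne 1             = 1
atMostOne (suc (suc _)) = 0

endingWeight : ℕ → ℕ
endingWeight 0                   = 0
endingWeight 1                   = 0
endingWeight 2                   = 1
endingWeight (suc (suc (suc _))) = 2

appendSum-atMostOne : ∀ M → appendSum atMostOne M ≡ atMostOne M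
appendSum-atMostOne 0                   = refl
appendSum-atMostOne 1                   = refl
appendSum-atMostOne 2                   = refl
appendSum-atMostOne (suc (suc (suc _))) = refl

appendSum-endingWeight : ∀ M → appendSum endingWeight M ≡ 4 ℕ.* endingWeight M + atMostOne M
appendSum-endingWeight 0                   = refl
appendSum-endingWeight 1                   = refl
appendSum-endingWeight 2                   = refl
appendSum-endingWeight (suc (suc (suc _))) = refl

countByMax-atMostOne : ∀ n → countByMax atMostOne n ≡ 1
countByMax-atMostOne zero    = refl
countByMax-atMostOne (suc n) = begin
  countByMax atMostOne (suc n)             ≡⟨ countByMax-suc atMostOne n ⟩
  countByMax (appendSum atMostOne) n       ≡⟨ countByMax-cong n appendSum-atMostOne ⟩
  countByMax atMostOne n                   ≡⟨ countByMax-atMostOne n ⟩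
  1                                        ∎

repunit₄ : ℕ → ℕ
repunit₄ zero    = 0
repunit₄ (suc m) = 4 ℕ.* repunit₄ m + 1

countByMax-endingWeight : ∀ n → countByMax endingWeight n ≡ repunit₄ n
countByMax-endingWeight zero    = refl
countByMax-endingWeight (suc n) = begin
  countByMax endingWeight (suc n)
    ≡⟨ countByMax-suc endingWeight n ⟩
  countByMax (appendSum endingWeight) n
    ≡⟨ countByMax-cong n appendSum-endingWeight ⟩
  countByMax (λ M → 4 ℕ.* endingWeight M + atMostOne M) n
    ≡⟨ countByMax-linear 4 endingWeight atMostOne n ⟩
  4 ℕ.* countByMax endingWeight n + countByMax atMostOne n
    ≡⟨ cong₂ (λ t s → 4 ℕ.* t + s) (countByMax-endingWeight n) (countByMax-atMostOne n) ⟩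
  repunit₄ (suc n) ∎

admissibleEnding : ℕ → ℕ → ℕ → ℕ → Bool
admissibleEnding k M y x =
  isRG (1 ⊔ M) (y ∷ x ∷ [])
  ∧ not ((x ≡ᵇ 1) ∨ (x ≡ᵇ suc (M ⊔ y)) ∨ (x ≡ᵇ 4))
  ∧ (y ≡ᵇ k)
  ∧ not ((x ≡ᵇ 1) ∨ (x ≡ᵇ suc M) ∨ (x ≡ᵇ 4))

inKplus2-snoc-snoc : ∀ k u y x →
  inKplus2 k ((u ++ [ y ]) ++ [ x ]) ≡ inL u ∧ admissibleEnding k (maxPref u) y x
inKplus2-snoc-snoc k u y x = begin
  inKplus2 k ((u ++ [ y ]) ++ [ x ])
    ≡⟨ cong (splitLast2 k) reverse-snoc-snoc ⟩
  inKplus2' k (reverse (reverse u)) y x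
    ≡⟨ cong (λ q → inKplus2' k q y x) (reverse-involutive u) ⟩
  inKplus2' k u y x
    ≡⟨ cong₂ (λ b M → b ∧ not ((x ≡ᵇ 1) ∨ (x ≡ᵇ suc M) ∨ (x ≡ᵇ 4)) ∧ rest)
             (isRG-++ 1 u (y ∷ x ∷ []) (s≤s z≤n)) (maxPref-snoc u y) ⟩
  (inL u ∧ isRG (1 ⊔ maxPref u) (y ∷ x ∷ [])) ∧ _
    ≡⟨ ∧-assoc (inL u) _ _ ⟩
  inL u ∧ admissibleEnding k (maxPref u) y x ∎
  where
  rest : Bool
  rest = (y ≡ᵇ k) ∧ not ((x ≡ᵇ 1) ∨ (x ≡ᵇ suc (maxPref u)) ∨ (x ≡ᵇ 4))
  reverse-snoc-snoc : reverse ((u ++ [ y ]) ++ [ x ]) ≡ x ∷ y ∷ reverse u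
  reverse-snoc-snoc rewrite reverse-++ (u ++ [ y ]) [ x ] | reverse-++ u [ y ] = refl

countEndings : ℕ → ℕ → ℕ
countEndings k M = sumOver letters (λ y → sumOver letters (λ x → if admissibleEnding k M y x then 1 else 0))

countEndings≡endingWeight : ∀ k M → 1 ≤ k → k ≤ 3 → 1 ≤ M → countEndings k M ≡ endingWeight M
countEndings≡endingWeight 1 1                         _ _ _ = refl
countEndings≡endingWeight 1 2                         _ _ _ = refl
countEndings≡endingWeight 1 3                         _ _ _ = refl
countEndings≡endingWeight 1 (suc (suc (suc (suc _)))) _ _ _ = refl
countEndings≡endingWeight 2 1                         _ _ _ = refl
countEndings≡endingWeight 2 2                         _ _ _ = refl
countEndings≡endingWeight 2 3                         _ _ _ = refl
countEndings≡endingWeight 2 (suc (suc (suc (suc _)))) _ _ _ = refl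
countEndings≡endingWeight 3 1                         _ _ _ = refl
countEndings≡endingWeight 3 2                         _ _ _ = refl
countEndings≡endingWeight 3 3                         _ _ _ = refl
countEndings≡endingWeight 3 (suc (suc (suc (suc _)))) _ _ _ = refl
countEndings≡endingWeight (suc (suc (suc (suc _)))) _ _ (s≤s (s≤s (s≤s ()))) _

cardL≡countByMax : ∀ k → 1 ≤ k → k ≤ 3 → ∀ m → cardL k (suc (suc m)) ≡ countByMax endingWeight m
cardL≡countByMax k 1≤k k≤3 m = begin
  cardL k (suc (suc m))
    ≡⟨ length-filterᵇ (inKplus2 k) (allWords (suc (suc m))) ⟩
  sumOver (allWords (suc (suc m))) indicator
    ≡⟨ sumOver-allWords-snoc (suc m) indicator ⟩
  sumOver (allWords (suc m)) (λ v → sumOver letters (λ x → indicator (v ++ [ x ])))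
    ≡⟨ sumOver-allWords-snoc m _ ⟩
  sumOver (allWords m) (λ u → sumOver letters (λ y → sumOver letters (λ x → indicator ((u ++ [ y ]) ++ [ x ]))))
    ≡⟨ sumOver-cong (allWords m) endings ⟩
  countByMax endingWeight m ∎
  where
  indicator : List ℕ → ℕ
  indicator w = if inKplus2 k w then 1 else 0
  countEndings-if : ∀ b M → 1 ≤ M →
    sumOver letters (λ y → sumOver letters (λ x → if b ∧ admissibleEnding k M y x then 1 else 0))
    ≡ (if b then endingWeight M else 0)
  countEndings-if true  M 1≤M = countEndings≡endingWeight k M 1≤k k≤3 1≤M
  countEndings-if false M _   = refl
  endings : ∀ u → sumOver letters (λ y → sumOver letters (λ x → indicator ((u ++ [ y ]) ++ [ x ])))
                  ≡ byMax endingWeight u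
  endings u = trans (sumOver-cong letters (λ y → sumOver-cong letters (λ x →
                       cong (λ b → if b then 1 else 0) (inKplus2-snoc-snoc k u y x))))
                    (countEndings-if (inL u) (maxPref u) (maxPref≥1 u))

numerator : ℕ → ℕ
numerator m = (2 ^ m + 1) ℕ.* (2 ^ m + 2)

3*repunit₄+1≡2^m*2^m : ∀ m → 3 ℕ.* repunit₄ m + 1 ≡ 2 ^ m ℕ.* 2 ^ m
3*repunit₄+1≡2^m*2^m zero    = refl
3*repunit₄+1≡2^m*2^m (suc m) = begin
  3 ℕ.* (4 ℕ.* repunit₄ m + 1) + 1   ≡⟨ regroup (repunit₄ m) ⟩
  4 ℕ.* (3 ℕ.* repunit₄ m + 1)       ≡⟨ cong (4 ℕ.*_) (3*repunit₄+1≡2^m*2^m m) ⟩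
  4 ℕ.* (2 ^ m ℕ.* 2 ^ m)            ≡⟨ square-double (2 ^ m) ⟩
  2 ^ suc m ℕ.* 2 ^ suc m            ∎
  where
  regroup : ∀ r → 3 ℕ.* (4 ℕ.* r + 1) + 1 ≡ 4 ℕ.* (3 ℕ.* r + 1)
  regroup = solve-∀
  square-double : ∀ t → 4 ℕ.* (t ℕ.* t) ≡ (2 ℕ.* t) ℕ.* (2 ℕ.* t)
  square-double = solve-∀

numerator-suc : ∀ m → numerator (suc m) ≡ 2 ℕ.* numerator m + 6 ℕ.* repunit₄ m
numerator-suc m = ℕ.+-cancelʳ-≡ 2 _ _ (begin
  (2 ℕ.* t + 1) ℕ.* (2 ℕ.* t + 2) + 2       ≡⟨ expand t ⟩
  2 ℕ.* numerator m + 2 ℕ.* (t ℕ.* t)       ≡⟨ cong (λ s → 2 ℕ.* numerator m + 2 ℕ.* s) (3*repunit₄+1≡2^m*2^m m) ⟨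
  2 ℕ.* numerator m + 2 ℕ.* (3 ℕ.* r + 1)   ≡⟨ collect (numerator m) r ⟩
  2 ℕ.* numerator m + 6 ℕ.* r + 2           ∎)
  where
  t = 2 ^ m
  r = repunit₄ m
  expand : ∀ t → (2 ℕ.* t + 1) ℕ.* (2 ℕ.* t + 2) + 2 ≡ 2 ℕ.* ((t + 1) ℕ.* (t + 2)) + 2 ℕ.* (t ℕ.* t)
  expand = solve-∀
  collect : ∀ a r → 2 ℕ.* a + 2 ℕ.* (3 ℕ.* r + 1) ≡ 2 ℕ.* a + 6 ℕ.* r + 2
  collect = solve-∀

*6-distrib : ∀ a r → (2 ℕ.* a + r) ℕ.* 6 ≡ 2 ℕ.* (a ℕ.* 6) + 6 ℕ.* r
*6-distrib = solve-∀

g*6≡numerator : ∀ m → g m ℕ.* 6 ≡ numerator m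
g-suc : ∀ m → g (suc m) ≡ 2 ℕ.* g m + repunit₄ m

g*6≡numerator zero    = refl
g*6≡numerator (suc m) = begin
  g (suc m) ℕ.* 6                         ≡⟨ cong (ℕ._* 6) (g-suc m) ⟩
  (2 ℕ.* g m + repunit₄ m) ℕ.* 6          ≡⟨ *6-distrib (g m) (repunit₄ m) ⟩
  2 ℕ.* (g m ℕ.* 6) + 6 ℕ.* repunit₄ m    ≡⟨ cong (λ s → 2 ℕ.* s + 6 ℕ.* repunit₄ m) (g*6≡numerator m) ⟩
  2 ℕ.* numerator m + 6 ℕ.* repunit₄ m    ≡⟨ numerator-suc m ⟨
  numerator (suc m)                       ∎

g-suc m = begin
  numerator (suc m) / 6                           ≡⟨ cong (_/ 6) (numerator-suc m) ⟩
  (2 ℕ.* numerator m + 6 ℕ.* repunit₄ m) / 6      ≡⟨ cong (λ s → (2 ℕ.* s + 6 ℕ.* repunit₄ m) / 6) (g*6≡numerator m) ⟨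
  (2 ℕ.* (g m ℕ.* 6) + 6 ℕ.* repunit₄ m) / 6      ≡⟨ cong (_/ 6) (*6-distrib (g m) (repunit₄ m)) ⟨
  (2 ℕ.* g m + repunit₄ m) ℕ.* 6 / 6              ≡⟨ m*n/n≡m (2 ℕ.* g m + repunit₄ m) 6 ⟩
  2 ℕ.* g m + repunit₄ m                          ∎

+[m+n]-+m≡+n : ∀ m n → + (m + n) - + m ≡ + n
+[m+n]-+m≡+n m n = begin
  + (m + n) - + m         ≡⟨ ℤ.[+m]-[+n]≡m⊖n (m + n) m ⟩
  (m + n) ⊖ m             ≡⟨ cong ((m + n) ⊖_) (ℕ.+-identityʳ m) ⟨
  (m + n) ⊖ (m + 0)       ≡⟨ ℤ.+-cancelˡ-⊖ m n 0 ⟩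
  + n                     ∎

g-difference : ∀ m → + g (suc m) - + 2 * + g m ≡ + repunit₄ m
g-difference m = begin
  + g (suc m) - + 2 * + g m                   ≡⟨ cong₂ (λ a b → + a - b) (sym (g-suc m)) (ℤ.pos-* 2 (g m)) ⟨
  + (2 ℕ.* g m + repunit₄ m) - + (2 ℕ.* g m)  ≡⟨ +[m+n]-+m≡+n (2 ℕ.* g m) (repunit₄ m) ⟩
  + repunit₄ m                                ∎

mainTheorem2 : (m : ℕ) → let n = suc (suc m) in
    (+ cardL 1 n ≡ + g (suc m) - + 2 * + g m)
    × (+ cardL 2 n ≡ + g (suc m) - + 2 * + g m)
    × (+ cardL 3 n ≡ + g (suc m) - + 2 * + g m)
mainTheorem2 m = card 1 (s≤s z≤n) (s≤s z≤n) , card 2 (s≤s z≤n) (s≤s (s≤s z≤n)) , card 3 (s≤s z≤n) ℕ.≤-refl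
  where
  card : ∀ k → 1 ≤ k → k ≤ 3 → + cardL k (suc (suc m)) ≡ + g (suc m) - + 2 * + g m
  card k 1≤k k≤3 = begin
    + cardL k (suc (suc m))        ≡⟨ cong +_ (cardL≡countByMax k 1≤k k≤3 m) ⟩
    + countByMax endingWeight m    ≡⟨ cong +_ (countByMax-endingWeight m) ⟩
    + repunit₄ m                   ≡⟨ g-difference m ⟨
    + g (suc m) - + 2 * + g m      ∎
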